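{- Let $m$ be an odd positive integer. Then $\beta_{2m}(d) \geq 2d+2$ for every integer $d \geq 2m+1$, and $\beta_{2m}(d) \geq 2d+4$ for every integer $d \geq 3m+1$.
   Context: $\beta_{2m}(d)$ denotes the largest size of a set $A \subseteq \mathbb{Z}_2^d$ (of distinct elements) with no $2m$-element subset summing to $0$. -}

module Defs where

open import Data.Nat using (ℕ; zero; suc)
open import Data.Bool using (Bool; true; false; _xor_)
open import Data.Vec using (Vec; []; _∷_; zipWith; replicate)
open import Data.Fin using (Fin; zero; suc)
open import Data.Fin.Subset using (Subset; Side; inside; outside; ∣_∣)
open import Data.Product using (Σ; _×_)
open import Function using (_∘_)
open import Function.Definitions using (Injective)
open import Relation.Binary.PropositionalEquality using (_≡_)
open import Relation.Nullary using (¬_)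

ℤ₂^ : ℕ → Set
ℤ₂^ d = Vec Bool d

_⊕_ : ∀ {d} → ℤ₂^ d → ℤ₂^ d → ℤ₂^ d
_⊕_ = zipWith _xor_

𝟎 : ∀ {d} → ℤ₂^ d
𝟎 {d} = replicate d false

subsetSum : ∀ {k d} → (Fin k → ℤ₂^ d) → Subset k → ℤ₂^ d
subsetSum {zero}  A []            = 𝟎
subsetSum {suc k} A (inside ∷ S)  = A zero ⊕ subsetSum (A ∘ suc) S
subsetSum {suc k} A (outside ∷ S) = subsetSum (A ∘ suc) S

NoZeroSum : ∀ {k d} → ℕ → (Fin k → ℤ₂^ d) → Set
NoZeroSum n A = ∀ S → ∣ S ∣ ≡ n → ¬ (subsetSum A S ≡ 𝟎)

-- β_n(d) ≥ k : there is a set of k distinct elements of ℤ₂^d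
-- (an injective family Fin k → ℤ₂^d) with no n-element subset summing to 0.
β≥ : ℕ → ℕ → ℕ → Set
β≥ n d k = Σ (Fin k → ℤ₂^ d) (λ A → Injective _≡_ _≡_ A × NoZeroSum n A)

module Submission where

-- Proof idea (a doubling construction).  Call a family R of n vectors in ℤ₂^d
-- "2m-separated from u" if no nonempty subfamily of at most 2m members sums to 0 and
-- no subfamily of at most 2m members sums to u.  Then, for m odd, the 2(n+1) vectors
--     B = {0} ∪ R   and   B + u
-- are distinct and have no 2m-element zero sum.  Indeed, a zero sum over S ∪ (T + u)
-- with S, T ⊆ B gives Σ S + Σ T = (|T| mod 2)·u, so separation (applied to the
-- symmetric difference of the R-parts) forces |T| even and S, T to have the same
-- R-part; then |S| + |T| = 2m with |T| even contradicts m odd.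
--
-- The
-- corollary instantiates it twice: the d unit vectors are 2m-separated from any u of
-- weight 2m+1 (needs d ≥ 2m+1, giving 2d+2 vectors); adding one vector x of weight 2m
-- with |u| = |x + u| = 2m+1 keeps separation (needs d ≥ 3m+1, giving 2d+4 vectors).

open import Defs
open import Data.Nat using (ℕ; suc; _+_; _*_; _≤_)
open import Data.Nat.Divisibility using (_∣_)
open import Data.Product using (_×_)
open import Relation.Nullary using (¬_)

open import Level using (0ℓ)
open import Algebra.Bundles using (AbelianGroup)
import Algebra.Properties.Group as GroupProperties
import Algebra.Properties.CommutativeSemigroup as CommutativeSemigroupProperties
open import Data.Nat using (zero; _<_; z≤n; s≤s)
open import Data.Nat.Divisibility using (divides)
open import Data.Nat.Properties
  using (≤-trans; ≤-reflexive; <-≤-trans; <⇒≢; <⇒≤; +-mono-≤; +-suc; m<m+n; +-identityʳ; *-cancelˡ-≡; m≤n⇒∃[o]m+o≡n)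
open import Data.Nat.Tactic.RingSolver using (solve-∀)
open import Data.Bool using (Bool; true; false; not; _xor_; if_then_else_)
open import Data.Bool.Properties
  using (not-involutive; xor-assoc; xor-comm; xor-identityˡ; xor-identityʳ; xor-same)
open import Data.Vec using ([]; _∷_; _++_; replicate; splitAt)
open import Data.Vec.Properties
  using (zipWith-assoc; zipWith-comm; zipWith-identityˡ; zipWith-identityʳ; zipWith-++; zipWith-replicate)
import Data.Vec.Functional as Family
open import Data.Vec.Functional.Properties using (lookup-++ˡ; lookup-++ʳ)
open import Data.Fin using (Fin; zero; suc; _↑ˡ_; _↑ʳ_; join)
open import Data.Fin.Properties using (join-splitAt)
open import Data.Fin.Subset using (Subset; inside; outside; _∈_; ∣_∣; ⁅_⁆; ⊥; ⊤)
open import Data.Fin.Subset.Properties using (∣⊥∣≡0; ∣⊤∣≡n; ∣⁅x⁆∣≡1; x∈⁅x⁆; x∈⁅y⁆⇒x≡y; ∉⊥; ∣p∣≤∣x∷p∣)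
open import Data.Sum using (inj₁; inj₂; [_,_]′)
open import Data.Product using (_,_; proj₁; proj₂)
open import Data.Empty using (⊥-elim)
open import Function using (_∘_; id)
open import Function.Definitions using (Injective)
open import Relation.Binary.PropositionalEquality

⊕-self : ∀ {d} (x : ℤ₂^ d) → x ⊕ x ≡ 𝟎
⊕-self []      = refl
⊕-self (b ∷ x) = cong₂ _∷_ (xor-same b) (⊕-self x)

⊕-abelianGroup : ℕ → AbelianGroup 0ℓ 0ℓ
⊕-abelianGroup d = record
  { Carrier = ℤ₂^ d ; _≈_ = _≡_ ; _∙_ = _⊕_ ; ε = 𝟎 ; _⁻¹ = id
  ; isAbelianGroup = record
    { isGroup = record
      { isMonoid = record
        { isSemigroup = record
          { isMagma = record { isEquivalence = isEquivalence ; ∙-cong = cong₂ _⊕_ }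
          ; assoc = zipWith-assoc xor-assoc }
        ; identity = zipWith-identityˡ xor-identityˡ , zipWith-identityʳ xor-identityʳ }
      ; inverse = ⊕-self , ⊕-self
      ; ⁻¹-cong = id }
    ; comm = zipWith-comm xor-comm } }

module ℤ₂-laws {d : ℕ} where
  open AbelianGroup (⊕-abelianGroup d) public
    using (assoc; identityˡ; identityʳ; commutativeSemigroup)
  open GroupProperties (AbelianGroup.group (⊕-abelianGroup d)) public
    using (inverseˡ-unique; \\-leftDividesʳ; ∙-cancelʳ)
  open CommutativeSemigroupProperties commutativeSemigroup public
    using (interchange; x∙yz≈y∙xz)

open ℤ₂-laws

⊕-solve : ∀ {d} (x y z : ℤ₂^ d) → x ⊕ y ≡ z → y ≡ x ⊕ z
⊕-solve x y z eq = trans (sym (\\-leftDividesʳ x y)) (cong (x ⊕_) eq)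

_·_ : ∀ {d} → Bool → ℤ₂^ d → ℤ₂^ d
true  · u = u
false · u = 𝟎

⊕-· : ∀ {d} (b : Bool) (u : ℤ₂^ d) → u ⊕ (b · u) ≡ not b · u
⊕-· true  u = ⊕-self u
⊕-· false u = identityʳ u

∣⊕∣≤ : ∀ {d} (x y : ℤ₂^ d) → ∣ x ⊕ y ∣ ≤ ∣ x ∣ + ∣ y ∣
∣⊕∣≤ []          []          = z≤n
∣⊕∣≤ (true  ∷ x) (true  ∷ y) = ≤-trans (∣⊕∣≤ x y) (+-mono-≤ (∣p∣≤∣x∷p∣ inside x) (∣p∣≤∣x∷p∣ inside y))
∣⊕∣≤ (true  ∷ x) (false ∷ y) = s≤s (∣⊕∣≤ x y)
∣⊕∣≤ (false ∷ x) (true  ∷ y) = ≤-trans (s≤s (∣⊕∣≤ x y)) (≤-reflexive (sym (+-suc ∣ x ∣ ∣ y ∣)))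
∣⊕∣≤ (false ∷ x) (false ∷ y) = ∣⊕∣≤ x y

∣++∣ : ∀ {k l} (x : Subset k) (y : Subset l) → ∣ x ++ y ∣ ≡ ∣ x ∣ + ∣ y ∣
∣++∣ []            y = refl
∣++∣ (inside  ∷ x) y = cong suc (∣++∣ x y)
∣++∣ (outside ∷ x) y = ∣++∣ x y

lighter⇒≢ : ∀ {d} {x y : ℤ₂^ d} → ∣ x ∣ < ∣ y ∣ → x ≢ y
lighter⇒≢ lt eq = <⇒≢ lt (cong ∣_∣ eq)

parity : ℕ → Bool
parity zero    = false
parity (suc n) = not (parity n)

parity-double : ∀ n → parity (n + n) ≡ false
parity-double zero    = refl
parity-double (suc n) = trans (cong (not ∘ parity) (+-suc n n)) (trans (not-involutive _) (parity-double n))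

even⇒2∣ : ∀ n → parity n ≡ false → 2 ∣ n
even⇒2∣ zero          _  = divides 0 refl
even⇒2∣ (suc zero)    ()
even⇒2∣ (suc (suc n)) eq with even⇒2∣ n (trans (sym (not-involutive (parity n))) eq)
... | divides q n≡q*2 = divides (suc q) (cong (2 +_) n≡q*2)

2*≡+ : ∀ m → 2 * m ≡ m + m
2*≡+ m = cong (m +_) (+-identityʳ m)

odd≢double : ∀ t m → suc (t + t) ≢ m + m
odd≢double t m eq with trans (sym (cong not (parity-double t))) (trans (cong parity eq) (parity-double m))
... | ()

half-even : ∀ c m → c + c ≡ 2 * m → parity c ≡ false → 2 ∣ m
half-even c m size even = subst (2 ∣_) (*-cancelˡ-≡ c m 2 (trans (2*≡+ c) size)) (even⇒2∣ c even)

-- If (a ∷ S) and (b ∷ T) with S = T have total size 2m and (b ∷ T) has even size, then m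
-- is even: for a = b both halves have size m, and for a ≠ b the total size would be odd.
halves-even : ∀ {n} a b (S T : Subset n) m →
  ∣ a ∷ S ∣ + ∣ b ∷ T ∣ ≡ 2 * m → S ≡ T → parity ∣ b ∷ T ∣ ≡ false → 2 ∣ m
halves-even inside  inside  T .T m size refl even = half-even (suc ∣ T ∣) m size even
halves-even outside outside T .T m size refl even = half-even ∣ T ∣ m size even
halves-even inside  outside T .T m size refl _    = ⊥-elim (odd≢double ∣ T ∣ m (trans size (2*≡+ m)))
halves-even outside inside  T .T m size refl _    =
  ⊥-elim (odd≢double ∣ T ∣ m (trans (sym (+-suc ∣ T ∣ ∣ T ∣)) (trans size (2*≡+ m))))

subsetSum-cong : ∀ {k d} {A A′ : Fin k → ℤ₂^ d} → (∀ i → A i ≡ A′ i) →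
  ∀ S → subsetSum A S ≡ subsetSum A′ S
subsetSum-cong {zero}  eq []            = refl
subsetSum-cong {suc k} eq (inside  ∷ S) = cong₂ _⊕_ (eq zero) (subsetSum-cong (eq ∘ suc) S)
subsetSum-cong {suc k} eq (outside ∷ S) = subsetSum-cong (eq ∘ suc) S

subsetSum-⊕ : ∀ {k d} (A : Fin k → ℤ₂^ d) (S T : Subset k) →
  subsetSum A (S ⊕ T) ≡ subsetSum A S ⊕ subsetSum A T
subsetSum-⊕ A [] [] = sym (identityˡ 𝟎)
subsetSum-⊕ A (inside ∷ S) (inside ∷ T) = begin
  subsetSum (A ∘ suc) (S ⊕ T)                      ≡⟨ subsetSum-⊕ (A ∘ suc) S T ⟩
  ΣS ⊕ ΣT                                          ≡⟨ identityˡ (ΣS ⊕ ΣT) ⟨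
  𝟎 ⊕ (ΣS ⊕ ΣT)                                    ≡⟨ cong (_⊕ (ΣS ⊕ ΣT)) (⊕-self (A zero)) ⟨
  (A zero ⊕ A zero) ⊕ (ΣS ⊕ ΣT)                    ≡⟨ interchange (A zero) (A zero) ΣS ΣT ⟩
  (A zero ⊕ ΣS) ⊕ (A zero ⊕ ΣT)                    ∎
  where
  open ≡-Reasoning
  ΣS = subsetSum (A ∘ suc) S
  ΣT = subsetSum (A ∘ suc) T
subsetSum-⊕ A (inside ∷ S) (outside ∷ T) =
  trans (cong (A zero ⊕_) (subsetSum-⊕ (A ∘ suc) S T)) (sym (assoc (A zero) _ _))
subsetSum-⊕ A (outside ∷ S) (inside ∷ T) =
  trans (cong (A zero ⊕_) (subsetSum-⊕ (A ∘ suc) S T)) (x∙yz≈y∙xz (A zero) _ _)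
subsetSum-⊕ A (outside ∷ S) (outside ∷ T) = subsetSum-⊕ (A ∘ suc) S T

subsetSum-++ : ∀ {k l d} (A : Fin (k + l) → ℤ₂^ d) (S : Subset k) (T : Subset l) →
  subsetSum A (S ++ T) ≡ subsetSum (A ∘ (_↑ˡ l)) S ⊕ subsetSum (A ∘ (k ↑ʳ_)) T
subsetSum-++ A []            T = sym (identityˡ _)
subsetSum-++ A (inside  ∷ S) T =
  trans (cong (A zero ⊕_) (subsetSum-++ (A ∘ suc) S T)) (sym (assoc (A zero) _ _))
subsetSum-++ A (outside ∷ S) T = subsetSum-++ (A ∘ suc) S T

subsetSum-shift : ∀ {k d} (A : Fin k → ℤ₂^ d) (u : ℤ₂^ d) (S : Subset k) →
  subsetSum (λ i → A i ⊕ u) S ≡ subsetSum A S ⊕ (parity ∣ S ∣ · u)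
subsetSum-shift A u [] = sym (identityʳ 𝟎)
subsetSum-shift A u (inside ∷ S) = begin
  (A zero ⊕ u) ⊕ subsetSum (λ i → A (suc i) ⊕ u) S  ≡⟨ cong ((A zero ⊕ u) ⊕_) (subsetSum-shift (A ∘ suc) u S) ⟩
  (A zero ⊕ u) ⊕ (ΣS ⊕ (parity ∣ S ∣ · u))         ≡⟨ interchange (A zero) u ΣS _ ⟩
  (A zero ⊕ ΣS) ⊕ (u ⊕ (parity ∣ S ∣ · u))         ≡⟨ cong ((A zero ⊕ ΣS) ⊕_) (⊕-· (parity ∣ S ∣) u) ⟩
  (A zero ⊕ ΣS) ⊕ (not (parity ∣ S ∣) · u)         ∎
  where
  open ≡-Reasoning
  ΣS = subsetSum (A ∘ suc) S
subsetSum-shift A u (outside ∷ S) = subsetSum-shift (A ∘ suc) u S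

subsetSum-⊥ : ∀ {k d} (A : Fin k → ℤ₂^ d) → subsetSum A ⊥ ≡ 𝟎
subsetSum-⊥ {zero}  A = refl
subsetSum-⊥ {suc k} A = subsetSum-⊥ (A ∘ suc)

subsetSum-⁅⁆ : ∀ {k d} (A : Fin k → ℤ₂^ d) (i : Fin k) → subsetSum A ⁅ i ⁆ ≡ A i
subsetSum-⁅⁆ A zero    = trans (cong (A zero ⊕_) (subsetSum-⊥ (A ∘ suc))) (identityʳ (A zero))
subsetSum-⁅⁆ A (suc i) = subsetSum-⁅⁆ (A ∘ suc) i

subsetSum-0∷ : ∀ {k d} (A : Fin k → ℤ₂^ d) (T : Subset k) →
  subsetSum (λ i → false ∷ A i) T ≡ false ∷ subsetSum A T
subsetSum-0∷ A []            = refl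
subsetSum-0∷ A (inside  ∷ T) = cong (λ s → (false ∷ A zero) ⊕ s) (subsetSum-0∷ (A ∘ suc) T)
subsetSum-0∷ A (outside ∷ T) = subsetSum-0∷ (A ∘ suc) T

subsetSum-units : ∀ {d} (T : Subset d) → subsetSum ⁅_⁆ T ≡ T
subsetSum-units []            = refl
subsetSum-units (inside  ∷ T) =
  trans (cong (⁅ zero ⁆ ⊕_) (subsetSum-0∷ ⁅_⁆ T)) (cong (true ∷_) (trans (identityˡ _) (subsetSum-units T)))
subsetSum-units (outside ∷ T) = trans (subsetSum-0∷ ⁅_⁆ T) (cong (false ∷_) (subsetSum-units T))

Separated : ∀ {n d} → ℕ → ℤ₂^ d → (Fin n → ℤ₂^ d) → Set
Separated k u R = ∀ T → ∣ T ∣ ≤ k → (subsetSum R T ≡ 𝟎 → T ≡ 𝟎) × subsetSum R T ≢ u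

separated-mono : ∀ {n d j k} {u : ℤ₂^ d} {R : Fin n → ℤ₂^ d} → j ≤ k → Separated k u R → Separated j u R
separated-mono j≤k sep T ∣T∣≤j = sep T (≤-trans ∣T∣≤j j≤k)

-- Two subfamilies of total size at most k whose sums differ by 0 or by u coincide, and the
-- difference is 0: apply separation to their symmetric difference S ⊕ T.
separated-pair : ∀ {n d k} {u : ℤ₂^ d} {R : Fin n → ℤ₂^ d} → Separated k u R →
  ∀ S T p → ∣ S ∣ + ∣ T ∣ ≤ k → subsetSum R S ⊕ subsetSum R T ≡ p · u → p ≡ false × S ≡ T
separated-pair {R = R} sep S T p size eq with sep (S ⊕ T) (≤-trans (∣⊕∣≤ S T) size)
... | sum≡𝟎⇒𝟎 , sum≢u with p
...   | false = refl , inverseˡ-unique S T (sum≡𝟎⇒𝟎 (trans (subsetSum-⊕ R S T) eq))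
...   | true  = ⊥-elim (sum≢u (trans (subsetSum-⊕ R S T) eq))

subsetSum-𝟎∷ : ∀ {n d} (R : Fin n → ℤ₂^ d) a (T : Subset n) →
  subsetSum (𝟎 Family.∷ R) (a ∷ T) ≡ subsetSum R T
subsetSum-𝟎∷ R inside  T = identityˡ (subsetSum R T)
subsetSum-𝟎∷ R outside T = refl

-- Each member of 𝟎 ∷ R is the R-sum over an index set of size at most one, its support.
support : ∀ {n} → Fin (suc n) → Subset n
support zero    = ⊥
support (suc i) = ⁅ i ⁆

member-as-sum : ∀ {n d} (R : Fin n → ℤ₂^ d) b → (𝟎 Family.∷ R) b ≡ subsetSum R (support b)
member-as-sum R zero    = sym (subsetSum-⊥ R)
member-as-sum R (suc i) = sym (subsetSum-⁅⁆ R i)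

∣support∣≤1 : ∀ {n} (b : Fin (suc n)) → ∣ support b ∣ ≤ 1
∣support∣≤1 {n} zero = ≤-trans (≤-reflexive (∣⊥∣≡0 n)) z≤n
∣support∣≤1 (suc i) = ≤-reflexive (∣⁅x⁆∣≡1 i)

support-injective : ∀ {n} (a b : Fin (suc n)) → support a ≡ support b → a ≡ b
support-injective zero    zero    _  = refl
support-injective zero    (suc j) eq = ⊥-elim (∉⊥ (subst (j ∈_) (sym eq) (x∈⁅x⁆ j)))
support-injective (suc i) zero    eq = ⊥-elim (∉⊥ (subst (i ∈_) eq (x∈⁅x⁆ i)))
support-injective (suc i) (suc j) eq = cong suc (x∈⁅y⁆⇒x≡y j (subst (i ∈_) eq (x∈⁅x⁆ i)))

members-apart : ∀ {n d} {u : ℤ₂^ d} {R : Fin n → ℤ₂^ d} → Separated 2 u R →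
  ∀ a b p → (𝟎 Family.∷ R) a ⊕ (𝟎 Family.∷ R) b ≡ p · u → p ≡ false × a ≡ b
members-apart {R = R} sep a b p eq with separated-pair sep (support a) (support b) p
  (+-mono-≤ (∣support∣≤1 a) (∣support∣≤1 b))
  (trans (sym (cong₂ _⊕_ (member-as-sum R a) (member-as-sum R b))) eq)
... | p≡false , same-support = p≡false , support-injective a b same-support

doubled : ∀ {k d} → (Fin k → ℤ₂^ d) → ℤ₂^ d → Fin (k + k) → ℤ₂^ d
doubled B u = B Family.++ (λ i → B i ⊕ u)

splitAt-injective : ∀ k {l} {i j : Fin (k + l)} → Data.Fin.splitAt k i ≡ Data.Fin.splitAt k j → i ≡ j
splitAt-injective k {l} {i} {j} eq =
  trans (sym (join-splitAt k l i)) (trans (cong (join k l) eq) (join-splitAt k l j))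

doubled-injective : ∀ {k d} (B : Fin k → ℤ₂^ d) (u : ℤ₂^ d) →
  (∀ a b p → B a ⊕ B b ≡ p · u → p ≡ false × a ≡ b) → Injective _≡_ _≡_ (doubled B u)
doubled-injective {k} B u apart {i} {j} eq = splitAt-injective k (halves _ _ eq)
  where
  apart-false : ∀ a b → B a ⊕ B b ≡ 𝟎 → a ≡ b
  apart-false a b e = proj₂ (apart a b false e)
  not-u : ∀ a b → u ≢ B a ⊕ B b
  not-u a b e with apart a b true (sym e)
  ... | () , _
  halves : ∀ x y → [ B , (λ i → B i ⊕ u) ]′ x ≡ [ B , (λ i → B i ⊕ u) ]′ y → x ≡ y
  halves (inj₁ a) (inj₁ b) e = cong inj₁ (apart-false a b (trans (cong (_⊕ B b) e) (⊕-self (B b))))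
  halves (inj₂ a) (inj₂ b) e =
    cong inj₂ (apart-false a b (trans (cong (_⊕ B b) (∙-cancelʳ u (B a) (B b) e)) (⊕-self (B b))))
  halves (inj₁ a) (inj₂ b) e = ⊥-elim (not-u b a (⊕-solve (B b) u (B a) (sym e)))
  halves (inj₂ a) (inj₁ b) e = ⊥-elim (not-u a b (⊕-solve (B a) u (B b) e))

doubled-sum : ∀ {k d} (B : Fin k → ℤ₂^ d) (u : ℤ₂^ d) (S T : Subset k) →
  subsetSum (doubled B u) (S ++ T) ≡ subsetSum B S ⊕ (subsetSum B T ⊕ (parity ∣ T ∣ · u))
doubled-sum {k} B u S T = begin
  subsetSum (doubled B u) (S ++ T)
    ≡⟨ subsetSum-++ (doubled B u) S T ⟩
  subsetSum (doubled B u ∘ (_↑ˡ k)) S ⊕ subsetSum (doubled B u ∘ (k ↑ʳ_)) T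
    ≡⟨ cong₂ _⊕_ (subsetSum-cong (lookup-++ˡ B _) S) (subsetSum-cong (lookup-++ʳ B _) T) ⟩
  subsetSum B S ⊕ subsetSum (λ i → B i ⊕ u) T
    ≡⟨ cong (subsetSum B S ⊕_) (subsetSum-shift B u T) ⟩
  subsetSum B S ⊕ (subsetSum B T ⊕ (parity ∣ T ∣ · u))
    ∎
  where open ≡-Reasoning

-- For m odd and R 2m-separated from u, the doubled family of 𝟎 ∷ R has no zero sum of 2m
-- elements: a zero sum over S ++ T forces, by separation, ∣T∣ even and S, T equal off 𝟎.
doubled-zeroSumFree : ∀ {n d} m → ¬ 2 ∣ m → (u : ℤ₂^ d) (R : Fin n → ℤ₂^ d) →
  Separated (2 * m) u R → NoZeroSum (2 * m) (doubled (𝟎 Family.∷ R) u)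
doubled-zeroSumFree {n} m m-odd u R sep S size sum≡𝟎 with splitAt (suc n) S
... | a ∷ Sa , b ∷ Sb , refl = m-odd (halves-even a b Sa Sb m halves-size (proj₂ pair) (proj₁ pair))
  where
  B = 𝟎 Family.∷ R
  halves-size : ∣ a ∷ Sa ∣ + ∣ b ∷ Sb ∣ ≡ 2 * m
  halves-size = trans (sym (∣++∣ (a ∷ Sa) (b ∷ Sb))) size
  bound : ∣ Sa ∣ + ∣ Sb ∣ ≤ 2 * m
  bound = ≤-trans (+-mono-≤ (∣p∣≤∣x∷p∣ a Sa) (∣p∣≤∣x∷p∣ b Sb)) (≤-reflexive halves-size)
  p = parity ∣ b ∷ Sb ∣
  balance : subsetSum R Sa ⊕ subsetSum R Sb ≡ p · u
  balance = subst₂ (λ x y → x ⊕ y ≡ p · u) (subsetSum-𝟎∷ R a Sa) (subsetSum-𝟎∷ R b Sb)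
    (inverseˡ-unique _ (p · u)
      (trans (assoc (subsetSum B (a ∷ Sa)) _ _) (trans (sym (doubled-sum B u (a ∷ Sa) (b ∷ Sb))) sum≡𝟎)))
  pair : p ≡ false × Sa ≡ Sb
  pair = separated-pair sep Sa Sb p bound balance

doubling : ∀ {n d} m → 1 ≤ m → ¬ 2 ∣ m → (u : ℤ₂^ d) (R : Fin n → ℤ₂^ d) →
  Separated (2 * m) u R → β≥ (2 * m) d (2 * n + 2)
doubling {n} m m≥1 m-odd u R sep = subst (β≥ (2 * m) _) (size n)
  (doubled B u , doubled-injective B u (members-apart (separated-mono 2≤2m sep)) ,
   doubled-zeroSumFree m m-odd u R sep)
  where
  B = 𝟎 Family.∷ R
  2≤2m : 2 ≤ 2 * m
  2≤2m = +-mono-≤ m≥1 (+-mono-≤ m≥1 z≤n)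
  size : ∀ n → suc n + suc n ≡ 2 * n + 2
  size = solve-∀

-- The unit vectors of ℤ₂^d are k-separated from every u of weight greater than k,
-- since they sum over T to T itself.
units-separated : ∀ {d k} (u : ℤ₂^ d) → k < ∣ u ∣ → Separated k u ⁅_⁆
units-separated u k<∣u∣ T ∣T∣≤k =
  (λ sum≡𝟎 → trans (sym (subsetSum-units T)) sum≡𝟎) ,
  (λ sum≡u → lighter⇒≢ (≤-trans (s≤s ∣T∣≤k) k<∣u∣) (trans (sym (subsetSum-units T)) sum≡u))

-- Adjoining one vector x to the unit vectors keeps k-separation from u, provided x and
-- x ⊕ u have weight at least k: a sum x ⊕ T with ∣T∣ < k then equals neither 𝟎 nor u.
extended-units-separated : ∀ {d k} (x u : ℤ₂^ d) → k ≤ ∣ x ∣ → k < ∣ u ∣ → k ≤ ∣ x ⊕ u ∣ →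
  Separated k u (x Family.∷ ⁅_⁆)
extended-units-separated x u _ k<∣u∣ _ (outside ∷ T) size with units-separated u k<∣u∣ T size
... | sum≡𝟎⇒𝟎 , sum≢u = cong (false ∷_) ∘ sum≡𝟎⇒𝟎 , sum≢u
extended-units-separated x u k≤∣x∣ _ k≤∣x⊕u∣ (inside ∷ T) ∣T∣<k =
  (λ sum≡𝟎 → ⊥-elim (lighter⇒≢ (<-≤-trans ∣T∣<k k≤∣x∣)
                       (trans (⊕-solve x T 𝟎 (unit-sum sum≡𝟎)) (identityʳ x)))) ,
  (λ sum≡u → lighter⇒≢ (<-≤-trans ∣T∣<k k≤∣x⊕u∣) (⊕-solve x T u (unit-sum sum≡u)))
  where
  unit-sum : ∀ {c} → x ⊕ subsetSum ⁅_⁆ T ≡ c → x ⊕ T ≡ c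
  unit-sum = subst (λ s → x ⊕ s ≡ _) (subsetSum-units T)

⊕-block : ∀ {l} k a b (y y′ : ℤ₂^ l) →
  (replicate k a ++ y) ⊕ (replicate k b ++ y′) ≡ replicate k (a xor b) ++ (y ⊕ y′)
⊕-block k a b y y′ =
  trans (zipWith-++ _xor_ (replicate k a) y (replicate k b) y′)
        (cong (_++ (y ⊕ y′)) (zipWith-replicate _xor_ a b))

blocks : ∀ m r → Bool → Bool → Bool → ℤ₂^ (m + (m + (suc m + r)))
blocks m r p q s = replicate m p ++ (replicate m q ++ (replicate (suc m) s ++ ⊥ {r}))

blocks-⊕ : ∀ m r p q s p′ q′ s′ →
  blocks m r p q s ⊕ blocks m r p′ q′ s′ ≡ blocks m r (p xor p′) (q xor q′) (s xor s′)
blocks-⊕ m r p q s p′ q′ s′ =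
  trans (⊕-block m p p′ _ _) (cong (replicate m (p xor p′) ++_)
    (trans (⊕-block m q q′ _ _) (cong (replicate m (q xor q′) ++_)
      (trans (⊕-block (suc m) s s′ _ _) (cong (replicate (suc m) (s xor s′) ++_)
        (zipWith-replicate _xor_ false false))))))

∣replicate∣ : ∀ k b → ∣ replicate k b ∣ ≡ (if b then k else 0)
∣replicate∣ k true  = ∣⊤∣≡n k
∣replicate∣ k false = ∣⊥∣≡0 k

∣blocks∣ : ∀ m r p q s →
  ∣ blocks m r p q s ∣ ≡ (if p then m else 0) + ((if q then m else 0) + ((if s then suc m else 0) + 0))
∣blocks∣ m r p q s = begin
  ∣ blocks m r p q s ∣
    ≡⟨ ∣++∣ (replicate m p) _ ⟩
  ∣ replicate m p ∣ + ∣ replicate m q ++ (replicate (suc m) s ++ ⊥ {r}) ∣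
    ≡⟨ cong (∣ replicate m p ∣ +_) (∣++∣ (replicate m q) _) ⟩
  ∣ replicate m p ∣ + (∣ replicate m q ∣ + ∣ replicate (suc m) s ++ ⊥ {r} ∣)
    ≡⟨ cong (λ w → ∣ replicate m p ∣ + (∣ replicate m q ∣ + w)) (∣++∣ (replicate (suc m) s) (⊥ {r})) ⟩
  ∣ replicate m p ∣ + (∣ replicate m q ∣ + (∣ replicate (suc m) s ∣ + ∣ ⊥ {r} ∣))
    ≡⟨ cong₂ _+_ (∣replicate∣ m p) (cong₂ _+_ (∣replicate∣ m q) (cong₂ _+_ (∣replicate∣ (suc m) s) (∣⊥∣≡0 r))) ⟩
  (if p then m else 0) + ((if q then m else 0) + ((if s then suc m else 0) + 0))
    ∎
  where open ≡-Reasoning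

∣⊤++⊥∣ : ∀ a b → ∣ ⊤ {a} ++ ⊥ {b} ∣ ≡ a
∣⊤++⊥∣ a b = trans (∣++∣ (⊤ {a}) (⊥ {b})) (trans (cong₂ _+_ (∣⊤∣≡n a) (∣⊥∣≡0 b)) (+-identityʳ a))

β-units : ∀ m r → 1 ≤ m → ¬ 2 ∣ m → let d = 2 * m + 1 + r in β≥ (2 * m) d (2 * d + 2)
β-units m r m≥1 m-odd = doubling m m≥1 m-odd u ⁅_⁆ (units-separated u 2m<∣u∣)
  where
  u : ℤ₂^ (2 * m + 1 + r)
  u = ⊤ {2 * m + 1} ++ ⊥ {r}
  2m<∣u∣ : 2 * m < ∣ u ∣
  2m<∣u∣ = subst (2 * m <_) (sym (∣⊤++⊥∣ (2 * m + 1) r)) (m<m+n (2 * m) (s≤s z≤n))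

-- β_{2m}(d) ≥ 2d + 4 in dimension d = 3m + 1 + r: double the unit vectors together with
-- x = 1^m 1^m 0^(m+1) 0^r; they are 2m-separated from u = 0^m 1^m 1^(m+1) 0^r because
-- ∣x∣ = 2m and ∣u∣ = ∣x ⊕ u∣ = 2m + 1.
β-extended : ∀ m r → 1 ≤ m → ¬ 2 ∣ m → let d = 3 * m + 1 + r in β≥ (2 * m) d (2 * d + 4)
β-extended m r m≥1 m-odd = subst₂ (β≥ (2 * m)) (dimension m r) (size m r)
  (doubling m m≥1 m-odd u (x Family.∷ ⁅_⁆) (extended-units-separated x u 2m≤∣x∣ 2m<∣u∣ 2m≤∣x⊕u∣))
  where
  D = m + (m + (suc m + r))
  x u : ℤ₂^ D
  x = blocks m r true  true false
  u = blocks m r false true true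
  2m<2m+1 : 2 * m < m + (suc m + 0)
  2m<2m+1 = ≤-reflexive (lemma m)
    where
    lemma : ∀ m → suc (2 * m) ≡ m + (suc m + 0)
    lemma = solve-∀
  2m≤∣x∣ : 2 * m ≤ ∣ x ∣
  2m≤∣x∣ = ≤-reflexive (sym (∣blocks∣ m r true true false))
  2m<∣u∣ : 2 * m < ∣ u ∣
  2m<∣u∣ = subst (2 * m <_) (sym (∣blocks∣ m r false true true)) 2m<2m+1
  2m≤∣x⊕u∣ : 2 * m ≤ ∣ x ⊕ u ∣
  2m≤∣x⊕u∣ = subst (2 * m ≤_) (sym (trans (cong ∣_∣ (blocks-⊕ m r true true false false true true))
                                           (∣blocks∣ m r true false true)))
                   (<⇒≤ 2m<2m+1)
  dimension : ∀ m r → m + (m + (suc m + r)) ≡ 3 * m + 1 + r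
  dimension = solve-∀
  size : ∀ m r → 2 * suc (m + (m + (suc m + r))) + 2 ≡ 2 * (3 * m + 1 + r) + 4
  size = solve-∀

from-offset : ∀ {P : ℕ → Set} a → (∀ r → P (a + r)) → ∀ d → a ≤ d → P d
from-offset a P-offset d a≤d with m≤n⇒∃[o]m+o≡n a≤d
... | r , refl = P-offset r

corollary2 : (m : ℕ) → 1 ≤ m → ¬ (2 ∣ m) →
    ((d : ℕ) → 2 * m + 1 ≤ d → β≥ (2 * m) d (2 * d + 2))
    × ((d : ℕ) → 3 * m + 1 ≤ d → β≥ (2 * m) d (2 * d + 4))
corollary2 m m≥1 m-odd =
  from-offset (2 * m + 1) (λ r → β-units m r m≥1 m-odd) ,
  from-offset (3 * m + 1) (λ r → β-extended m r m≥1 m-odd)
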